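{- There is an absolute constant $C>0$ such that for every connected finite undirected unweighted graph $G$ with $m$ edges, the competitive ratio of electric routing satisfies $\eta_{\mathcal{E}}\le C\,m^{1/2}$. Furthermore, there exist a constant $c>0$ and an infinite family of connected unweighted graphs $G_k$ with $m_k\to\infty$ edges such that $\eta_{\mathcal{E}}(G_k)\ge c\,m_k^{1/2}$ (witnessed by suitable demand sets).
   Context: Let $G=(V,E)$, $V=\{1,\dots,n\}$, with all edge weights $1$. Fix an arbitrary orientation of each edge. The discrete gradient $B\in\mathbb{R}^{E\times V}$ has, for an edge $e$ oriented $u\to v$, row $e$ equal to $\chi_u-\chi_v$ ($\chi_x$ the indicator vector of $x$). Let $W=I$ be the diagonal edge-weight matrix, $L=B^{T}WB$ the Laplacian and $L^{\dagger}$ its Moore–Penrose pseudoinverse. A single-commodity demand is $d=a(\chi_s-\chi_t)$ with $a>0$, $s\neq t$; a flow $f\in\mathbb{R}^E$ routes $d$ if $B^{T}f=d$. A demand set is a finite family $(d_\tau)_\tau$ of such demands, routed by a multi-commodity flow $(f_\tau)_\tau$ if $B^{T}f_\tau=d_\tau$ for all $\tau$. Congestion: $\|(f_\tau)_\tau\|_G:=\max_{e}\sum_\tau|f_{\tau,e}|/w_e$. Electric routing: $\mathcal{E}(d):=WBL^{\dagger}d$, applied to each demand separately. Competitive ratio: $\eta_{\mathcal{E}}:=\sup_{(d_\tau)}\sup_{(f_\tau):B^{T}f_\tau=d_\tau}\|(\mathcal{E}(d_\tau))_\tau\|_G/\|(f_\tau)_\tau\|_G$.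
   Formalization: In the upper bound, the demand amounts $a$ and the entries of the multi-commodity flows $(f_\tau)_\tau$ range only over the rationals instead of the reals. -}

module Defs where

open import Data.Nat as ℕ using (ℕ; zero; suc)
open import Data.Fin using (Fin; zero; suc; _≟_)
import Data.Product
open Data.Product using (_×_; _,_; proj₁; proj₂)
open import Data.Sum using (_⊎_)
open import Data.Rational using (ℚ; 0ℚ; 1ℚ; _+_; _*_; _-_; _⊔_; ∣_∣; _≤_; _<_)
open import Relation.Binary.PropositionalEquality using (_≡_; _≢_)
open import Relation.Nullary using (¬_; does)
open import Data.Bool using (if_then_else_)

Σ : (k : ℕ) → (Fin k → ℚ) → ℚ
Σ zero    f = 0ℚ
Σ (suc k) f = f zero + Σ k (λ i → f (suc i))

-- Maximum over Fin k (0 for k = 0; used only on nonnegative quantities).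
Max : (k : ℕ) → (Fin k → ℚ) → ℚ
Max zero    f = 0ℚ
Max (suc k) f = f zero ⊔ Max k (λ i → f (suc i))

χ : {n : ℕ} → Fin n → Fin n → ℚ
χ u x = if does (u ≟ x) then 1ℚ else 0ℚ

-- A finite undirected simple graph on V = Fin n with m edges, each edge e
-- given with a fixed (arbitrary) orientation edge e = (u , v), i.e. u → v.
record Graph (n m : ℕ) : Set where
  field
    edge   : Fin m → Fin n × Fin n
    noLoop : ∀ e → proj₁ (edge e) ≢ proj₂ (edge e)
    simple : ∀ e e' → (edge e ≡ edge e' ⊎ edge e ≡ (proj₂ (edge e') , proj₁ (edge e'))) → e ≡ e'
open Graph public

data Reach {n m : ℕ} (G : Graph n m) : Fin n → Fin n → Set where
  here : ∀ {x} → Reach G x x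
  fwd  : ∀ {x} e → Reach G (proj₂ (edge G e)) x → Reach G (proj₁ (edge G e)) x
  bwd  : ∀ {x} e → Reach G (proj₁ (edge G e)) x → Reach G (proj₂ (edge G e)) x

Connected : {n m : ℕ} → Graph n m → Set
Connected G = ∀ x y → Reach G x y

Matrix : ℕ → ℕ → Set
Matrix a b = Fin a → Fin b → ℚ

infixl 7 _⊗_
_⊗_ : {a b c : ℕ} → Matrix a b → Matrix b c → Matrix a c
_⊗_ {b = b} M N i j = Σ b (λ k → M i k * N k j)

transpose : {a b : ℕ} → Matrix a b → Matrix b a
transpose M i j = M j i

infix 4 _≐_
_≐_ : {a b : ℕ} → Matrix a b → Matrix a b → Set
M ≐ N = ∀ i j → M i j ≡ N i j

grad : {n m : ℕ} → Graph n m → Matrix m n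
grad G e x = χ (proj₁ (edge G e)) x - χ (proj₂ (edge G e)) x

-- Edge weights all 1: W = I.
W : {m : ℕ} → Matrix m m
W i j = χ i j

Lap : {n m : ℕ} → Graph n m → Matrix n n
Lap G = (transpose (grad G) ⊗ W) ⊗ grad G

IsPseudoinverse : {n : ℕ} → Matrix n n → Matrix n n → Set
IsPseudoinverse A P =
  ((A ⊗ P) ⊗ A ≐ A) × ((P ⊗ A) ⊗ P ≐ P) ×
  (transpose (A ⊗ P) ≐ (A ⊗ P)) × (transpose (P ⊗ A) ≐ (P ⊗ A))

record Demand (n : ℕ) : Set where
  field
    amount : ℚ
    pos    : 0ℚ < amount
    src    : Fin n
    snk    : Fin n
    distinct : src ≢ snk
open Demand public

demandVec : {n : ℕ} → Demand n → Fin n → ℚ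
demandVec d x = amount d * (χ (src d) x - χ (snk d) x)

DemandSet : ℕ → ℕ → Set
DemandSet n k = Fin k → Demand n

Routes : {n m : ℕ} → Graph n m → (Fin m → ℚ) → (Fin n → ℚ) → Set
Routes {n} {m} G f d = ∀ x → Σ m (λ e → grad G e x * f e) ≡ d x

RoutesSet : {n m k : ℕ} → Graph n m → DemandSet n k → (Fin k → Fin m → ℚ) → Set
RoutesSet G D F = ∀ τ → Routes G (F τ) (demandVec (D τ))

congestion : {m k : ℕ} → (Fin k → Fin m → ℚ) → ℚ
congestion {m} {k} F = Max m (λ e → Σ k (λ τ → ∣ F τ e ∣))

-- Electric routing 𝓔(d) = W B L† d, where P plays the role of L†.
electric : {n m : ℕ} → Graph n m → Matrix n n → (Fin n → ℚ) → Fin m → ℚ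
electric {n} {m} G P d e =
  Σ m (λ e' → W e e' * Σ n (λ x → grad G e' x * Σ n (λ y → P x y * d y)))

electricSet : {n m k : ℕ} → Graph n m → Matrix n n → DemandSet n k → Fin k → Fin m → ℚ
electricSet G P D τ = electric G P (demandVec (D τ))

Diverges : (ℕ → ℕ) → Set
Diverges ms = ∀ M → Data.Product.∃ λ K → ∀ k → K ℕ.≤ k → M ℕ.≤ ms k

{-# OPTIONS --safe #-}
-- Let Π = B L† Bᵀ.  The Penrose identity L L† L = L gives Π B = B and Bᵀ Π = Bᵀ, so the
-- electric routing of a demand routed by any flow f is Π f, and Π Πᵀ = Πᵀ.  The latter
-- says that every row of Π has Euclidean length at most 1, hence ℓ₁-length at most √m by
-- Cauchy–Schwarz: the electric load of an edge is at most √m times the congestion of f.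
--
-- For the lower bound join s and t by an edge and by K internally disjoint paths of
-- length K, so that m = K² + 1.  The flow 1/(K + 1) on every edge routes one unit from s
-- to t with congestion at most 1/√m.  The electric flow is a potential difference and is
-- conserved at the inner vertices, so it is constant along each path and every path
-- carries 1/K of the flow on the edge s t; conservation at s then forces the electric
-- flow on s t to be 1/2.
module Submission where

open import Defs
open import Algebra.Bundles using (CommutativeMonoid)
import Algebra.Properties.CommutativeSemigroup as CommSemigroupₚ
import Algebra.Properties.Group as Groupₚ
open import Data.Nat as ℕ using (ℕ; zero; suc)
import Data.Nat.Properties as ℕₚ
open import Data.Nat.Coprimality as Coprime using (1-coprimeTo)
open import Data.Fin as Fin using (Fin; zero; suc; inject₁; toℕ; combine; remQuot; _↑ˡ_; _↑ʳ_)
import Data.Fin.Properties as Finₚ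
open import Data.Fin.Induction using (<-weakInduction)
open import Data.Fin.Relation.Unary.Top using (view; ‵fromℕ; ‵inject₁; view-fromℕ; view-inject₁)
open import Data.Integer as ℤ using (+_)
import Data.Integer.Properties as ℤₚ
open import Data.Rational
open import Data.Rational.Properties
open import Data.Rational.Solver using (module +-*-Solver)
open import Data.Product using (Σ-syntax; ∃-syntax; _×_; _,_; proj₁; proj₂; uncurry; swap)
open import Data.Sum using (_⊎_; inj₁; inj₂)
open import Data.Empty using (⊥-elim)
open import Function using (_∘_)
open import Level using (0ℓ)
open import Relation.Binary using (Setoid; tri<; tri≈; tri>)
import Relation.Binary.Reasoning.Setoid as SetoidReasoning
open import Relation.Nullary using (¬_)
open import Relation.Nullary.Decidable using (dec-true; dec-false)
open import Relation.Binary.PropositionalEquality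

open +-*-Solver using (solve; _:+_; _:*_; _:-_; :-_; _:=_; con)

+-interchange : ∀ a b c d → (a + b) + (c + d) ≡ (a + c) + (b + d)
+-interchange = CommSemigroupₚ.interchange (CommutativeMonoid.commutativeSemigroup +-0-commutativeMonoid)

-‿interchange : ∀ a b c d → (a - b) + (c - d) ≡ (a + c) - (b + d)
-‿interchange = solve 4 (λ a b c d → (a :- b) :+ (c :- d) := (a :+ c) :- (b :+ d)) refl

-‿telescope : ∀ a b c → (a - b) + (b - c) ≡ a - c
-‿telescope = solve 3 (λ a b c → (a :- b) :+ (b :- c) := a :- c) refl

*-interchange : ∀ a b c d → (a * b) * (c * d) ≡ (a * c) * (b * d)
*-interchange = CommSemigroupₚ.interchange (CommutativeMonoid.commutativeSemigroup *-1-commutativeMonoid)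

*-distribˡ-- : ∀ a b c → a * (b - c) ≡ a * b - a * c
*-distribˡ-- = solve 3 (λ a b c → a :* (b :- c) := a :* b :- a :* c) refl

*-distribʳ-- : ∀ a b c → (a - b) * c ≡ a * c - b * c
*-distribʳ-- = solve 3 (λ a b c → (a :- b) :* c := a :* c :- b :* c) refl

-- The normal form of + n / 1.  Unlike + n / 1 it reduces, so that instances such as
-- Positive (fromℕ (suc n)) are found by computation.
fromℕ : ℕ → ℚ
fromℕ n = mkℚ (+ n) 0 (Coprime.sym (1-coprimeTo n))

n/1≡fromℕ : ∀ n → + n / 1 ≡ fromℕ n
n/1≡fromℕ n = normalize-coprime (Coprime.sym (1-coprimeTo n))

fromℕ-suc : ∀ n → fromℕ (suc n) ≡ 1ℚ + fromℕ n
fromℕ-suc n = trans (sym (n/1≡fromℕ (suc n))) (cong (λ z → (+ 1 ℤ.+ z) / 1) (sym (ℤₚ.*-identityʳ (+ n))))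

fromℕ-* : ∀ a b → fromℕ (a ℕ.* b) ≡ fromℕ a * fromℕ b
fromℕ-* a b = trans (sym (n/1≡fromℕ (a ℕ.* b))) (cong (_/ 1) (ℤₚ.pos-* a b))

fromℕ-mono-≤ : ∀ {a b} → a ℕ.≤ b → fromℕ a ≤ fromℕ b
fromℕ-mono-≤ {a} {b} a≤b = *≤* (subst₂ ℤ._≤_ (sym (ℤₚ.*-identityʳ (+ a))) (sym (ℤₚ.*-identityʳ (+ b))) (ℤ.+≤+ a≤b))

0≤fromℕ : ∀ n → 0ℚ ≤ fromℕ n
0≤fromℕ n = nonNegative⁻¹ (fromℕ n)

0≤p*q : ∀ {p q} → 0ℚ ≤ p → 0ℚ ≤ q → 0ℚ ≤ p * q
0≤p*q {p} {q} 0≤p 0≤q = nonNegative⁻¹ _ {{nonNeg*nonNeg⇒nonNeg p {{nonNegative 0≤p}} q {{nonNegative 0≤q}}}}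

0≤p*p : ∀ p → 0ℚ ≤ p * p
0≤p*p p with ≤-total 0ℚ p
... | inj₁ 0≤p = 0≤p*q 0≤p 0≤p
... | inj₂ p≤0 = nonNegative⁻¹ _ {{nonPos*nonPos⇒nonPos p {{nonPositive p≤0}} p {{nonPositive p≤0}}}}

p*p≡0⇒p≡0 : ∀ p → p * p ≡ 0ℚ → p ≡ 0ℚ
p*p≡0⇒p≡0 p p*p≡0 with <-cmp p 0ℚ
... | tri< p<0 _ _ = ⊥-elim (<-irrefl (sym p*p≡0) (positive⁻¹ _ {{neg*neg⇒pos p {{negative p<0}} p {{negative p<0}}}}))
... | tri≈ _ p≡0 _ = p≡0
... | tri> _ _ p>0 = ⊥-elim (<-irrefl (sym p*p≡0) (positive⁻¹ _ {{pos*pos⇒pos p {{positive p>0}} p {{positive p>0}}}}))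

p≤q⇒p*p≤q*q : ∀ {p q} → 0ℚ ≤ p → p ≤ q → p * p ≤ q * q
p≤q⇒p*p≤q*q {p} {q} 0≤p p≤q =
  ≤-trans (*-monoʳ-≤-nonNeg p {{nonNegative 0≤p}} p≤q) (*-monoˡ-≤-nonNeg q {{nonNegative (≤-trans 0≤p p≤q)}} p≤q)

p*p≤p⇒p≤1 : ∀ {p} → p * p ≤ p → p ≤ 1ℚ
p*p≤p⇒p≤1 {p} p*p≤p with <-cmp p 1ℚ
... | tri< p<1 _ _ = <⇒≤ p<1
... | tri≈ _ p≡1 _ = ≤-reflexive p≡1
... | tri> _ _ p>1 = ⊥-elim (<-irrefl refl (<-≤-trans p<p*p p*p≤p))
  where
  p<p*p : p < p * p
  p<p*p = subst (_< p * p) (*-identityʳ p) (*-monoʳ-<-pos p {{positive (<-trans (positive⁻¹ 1ℚ) p>1)}} p>1)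

p+p≤q+q⇒p≤q : ∀ {p q} → p + p ≤ q + q → p ≤ q
p+p≤q+q⇒p≤q {p} {q} 2p≤2q with <-cmp p q
... | tri< p<q _ _ = <⇒≤ p<q
... | tri≈ _ p≡q _ = ≤-reflexive p≡q
... | tri> _ _ p>q = ⊥-elim (<-irrefl refl (<-≤-trans (+-mono-< p>q p>q) 2p≤2q))

0≤q-p⇒p≤q : ∀ {p q} → 0ℚ ≤ q - p → p ≤ q
0≤q-p⇒p≤q {p} {q} 0≤q-p = subst₂ _≤_ (+-identityʳ p) (p+[q-p]≡q p q) (+-monoʳ-≤ p 0≤q-p)
  where
  p+[q-p]≡q : ∀ p q → p + (q - p) ≡ q
  p+[q-p]≡q = solve 2 (λ p q → p :+ (q :- p) := q) refl

p-q≡0⇒p≡q : ∀ {p q} → p - q ≡ 0ℚ → p ≡ q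
p-q≡0⇒p≡q {p} {q} = Groupₚ.x∙y⁻¹≈ε⇒x≈y +-0-group p q

Σ-cong : ∀ n {f g : Fin n → ℚ} → (∀ i → f i ≡ g i) → Σ n f ≡ Σ n g
Σ-cong zero    f≗g = refl
Σ-cong (suc n) f≗g = cong₂ _+_ (f≗g zero) (Σ-cong n (f≗g ∘ suc))

Σ-zero : ∀ n {f : Fin n → ℚ} → (∀ i → f i ≡ 0ℚ) → Σ n f ≡ 0ℚ
Σ-zero zero    f≗0 = refl
Σ-zero (suc n) f≗0 = cong₂ _+_ (f≗0 zero) (Σ-zero n (f≗0 ∘ suc))

Σ-distrib-+ : ∀ n (f g : Fin n → ℚ) → Σ n (λ i → f i + g i) ≡ Σ n f + Σ n g
Σ-distrib-+ zero    f g = refl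
Σ-distrib-+ (suc n) f g =
  trans (cong (_+_ (f zero + g zero)) (Σ-distrib-+ n (f ∘ suc) (g ∘ suc)))
        (+-interchange (f zero) (g zero) _ _)

Σ-distrib-- : ∀ n (f g : Fin n → ℚ) → Σ n (λ i → f i - g i) ≡ Σ n f - Σ n g
Σ-distrib-- zero    f g = refl
Σ-distrib-- (suc n) f g =
  trans (cong (_+_ (f zero - g zero)) (Σ-distrib-- n (f ∘ suc) (g ∘ suc)))
        (-‿interchange (f zero) (g zero) _ _)

*-distribˡ-Σ : ∀ n c (f : Fin n → ℚ) → c * Σ n f ≡ Σ n (λ i → c * f i)
*-distribˡ-Σ zero    c f = *-zeroʳ c
*-distribˡ-Σ (suc n) c f = trans (*-distribˡ-+ c (f zero) _) (cong (_+_ (c * f zero)) (*-distribˡ-Σ n c (f ∘ suc)))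

*-distribʳ-Σ : ∀ n c (f : Fin n → ℚ) → Σ n f * c ≡ Σ n (λ i → f i * c)
*-distribʳ-Σ n c f = trans (*-comm (Σ n f) c) (trans (*-distribˡ-Σ n c f) (Σ-cong n (λ i → *-comm c (f i))))

Σ-comm : ∀ a b (f : Fin a → Fin b → ℚ) → Σ a (λ i → Σ b (f i)) ≡ Σ b (λ j → Σ a (λ i → f i j))
Σ-comm zero    b f = sym (Σ-zero b (λ _ → refl))
Σ-comm (suc a) b f = trans (cong (_+_ (Σ b (f zero))) (Σ-comm a b (f ∘ suc))) (sym (Σ-distrib-+ b (f zero) _))

Σ-const : ∀ n c → Σ n (λ _ → c) ≡ fromℕ n * c
Σ-const zero    c = sym (*-zeroˡ c)
Σ-const (suc n) c = begin
  c + Σ n (λ _ → c)       ≡⟨ cong (_+_ c) (Σ-const n c) ⟩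
  c + fromℕ n * c         ≡⟨ cong (_+ fromℕ n * c) (*-identityˡ c) ⟨
  1ℚ * c + fromℕ n * c    ≡⟨ *-distribʳ-+ c 1ℚ (fromℕ n) ⟨
  (1ℚ + fromℕ n) * c      ≡⟨ cong (_* c) (fromℕ-suc n) ⟨
  fromℕ (suc n) * c       ∎
  where open ≡-Reasoning

Σ-single : ∀ n {f : Fin n → ℚ} i → (∀ j → j ≢ i → f j ≡ 0ℚ) → Σ n f ≡ f i
Σ-single (suc n) {f} zero    f≗0 =
  trans (cong (_+_ (f zero)) (Σ-zero n (λ j → f≗0 (suc j) λ ()))) (+-identityʳ (f zero))
Σ-single (suc n) {f} (suc i) f≗0 =
  trans (cong₂ _+_ (f≗0 zero λ ()) (Σ-single n i (λ j j≢i → f≗0 (suc j) (j≢i ∘ Finₚ.suc-injective))))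
        (+-identityˡ (f (suc i)))

Σ-↑ : ∀ a b (f : Fin (a ℕ.+ b) → ℚ) → Σ (a ℕ.+ b) f ≡ Σ a (λ i → f (i ↑ˡ b)) + Σ b (λ j → f (a ↑ʳ j))
Σ-↑ zero    b f = sym (+-identityˡ _)
Σ-↑ (suc a) b f = trans (cong (_+_ (f zero)) (Σ-↑ a b (f ∘ suc))) (sym (+-assoc (f zero) _ _))

Σ-combine : ∀ a b (f : Fin (a ℕ.* b) → ℚ) → Σ (a ℕ.* b) f ≡ Σ a (λ i → Σ b (λ j → f (combine i j)))
Σ-combine zero    b f = refl
Σ-combine (suc a) b f = trans (Σ-↑ b (a ℕ.* b) f) (cong (_+_ (Σ b (λ j → f (j ↑ˡ (a ℕ.* b))))) (Σ-combine a b (f ∘ (b ↑ʳ_))))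

Σ-telescope : ∀ n (h : Fin (suc n) → ℚ) → Σ n (λ i → h (inject₁ i) - h (suc i)) ≡ h zero - h (Fin.fromℕ n)
Σ-telescope zero    h = sym (+-inverseʳ (h zero))
Σ-telescope (suc n) h =
  trans (cong (_+_ (h zero - h (suc zero))) (Σ-telescope n (h ∘ suc))) (-‿telescope (h zero) (h (suc zero)) _)

Σ-mono-≤ : ∀ n {f g : Fin n → ℚ} → (∀ i → f i ≤ g i) → Σ n f ≤ Σ n g
Σ-mono-≤ zero    f≤g = ≤-refl
Σ-mono-≤ (suc n) f≤g = +-mono-≤ (f≤g zero) (Σ-mono-≤ n (f≤g ∘ suc))

0≤Σ : ∀ n {f : Fin n → ℚ} → (∀ i → 0ℚ ≤ f i) → 0ℚ ≤ Σ n f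
0≤Σ n {f} 0≤f = subst (_≤ Σ n f) (Σ-zero n (λ _ → refl)) (Σ-mono-≤ n 0≤f)

≤Σ : ∀ n {f : Fin n → ℚ} → (∀ i → 0ℚ ≤ f i) → ∀ i → f i ≤ Σ n f
≤Σ (suc n) {f} 0≤f zero    = subst (_≤ Σ (suc n) f) (+-identityʳ (f zero)) (+-monoʳ-≤ (f zero) (0≤Σ n (0≤f ∘ suc)))
≤Σ (suc n) {f} 0≤f (suc i) = subst (_≤ Σ (suc n) f) (+-identityˡ (f (suc i))) (+-mono-≤ (0≤f zero) (≤Σ n (0≤f ∘ suc) i))

∣Σ∣≤Σ∣∣ : ∀ n (f : Fin n → ℚ) → ∣ Σ n f ∣ ≤ Σ n (λ i → ∣ f i ∣)
∣Σ∣≤Σ∣∣ zero    f = ≤-refl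
∣Σ∣≤Σ∣∣ (suc n) f = ≤-trans (∣p+q∣≤∣p∣+∣q∣ (f zero) _) (+-monoʳ-≤ ∣ f zero ∣ (∣Σ∣≤Σ∣∣ n (f ∘ suc)))

χ-diag-* : ∀ {n} (u : Fin n) v → χ u u * v ≡ v
χ-diag-* u v rewrite dec-true (u Fin.≟ u) refl = *-identityˡ v

χ-off-* : ∀ {n} {u x : Fin n} → u ≢ x → ∀ v → χ u x * v ≡ 0ℚ
χ-off-* {u = u} {x} u≢x v rewrite dec-false (u Fin.≟ x) u≢x = *-zeroˡ v

Σ-χ-single : ∀ {N} n {x : Fin N} (σ : Fin n → Fin N) (f : Fin n → ℚ) i →
             σ i ≡ x → (∀ j → σ j ≡ x → j ≡ i) → Σ n (λ j → χ (σ j) x * f j) ≡ f i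
Σ-χ-single n σ f i refl σ≡x⇒≡i =
  trans (Σ-single n i (λ j j≢i → χ-off-* (j≢i ∘ σ≡x⇒≡i j) (f j))) (χ-diag-* (σ i) (f i))

Σ-χ-none : ∀ {N} n {x : Fin N} (σ : Fin n → Fin N) (f : Fin n → ℚ) →
           (∀ j → σ j ≢ x) → Σ n (λ j → χ (σ j) x * f j) ≡ 0ℚ
Σ-χ-none n σ f σ≢x = Σ-zero n (λ j → χ-off-* (σ≢x j) (f j))

Σ-χˡ : ∀ n (i : Fin n) (f : Fin n → ℚ) → Σ n (λ j → χ i j * f j) ≡ f i
Σ-χˡ n i f = trans (Σ-single n i (λ j j≢i → χ-off-* (j≢i ∘ sym) (f j))) (χ-diag-* i (f i))

Σ-χʳ : ∀ n (i : Fin n) (f : Fin n → ℚ) → Σ n (λ j → f j * χ j i) ≡ f i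
Σ-χʳ n i f = trans (Σ-single n i (λ j j≢i → trans (*-comm (f j) _) (χ-off-* j≢i (f j))))
                   (trans (*-comm (f i) _) (χ-diag-* i (f i)))

≤-Max : ∀ n (f : Fin n → ℚ) i → f i ≤ Max n f
≤-Max (suc n) f zero    = p≤p⊔q (f zero) _
≤-Max (suc n) f (suc i) = ≤-trans (≤-Max n (f ∘ suc) i) (p≤q⊔p (f zero) _)

Max-cong : ∀ n {f g : Fin n → ℚ} → (∀ i → f i ≡ g i) → Max n f ≡ Max n g
Max-cong zero    f≗g = refl
Max-cong (suc n) f≗g = cong₂ _⊔_ (f≗g zero) (Max-cong n (f≗g ∘ suc))

Max-const : ∀ n {v} → 0ℚ ≤ v → Max (suc n) (λ _ → v) ≡ v
Max-const zero    0≤v = p≥q⇒p⊔q≡p 0≤v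
Max-const (suc n) {v} 0≤v = trans (cong (v ⊔_) (Max-const n 0≤v)) (⊔-idem v)

Max-square-≤ : ∀ n (f : Fin n → ℚ) {b} → 0ℚ ≤ b → (∀ i → f i * f i ≤ b) → Max n f * Max n f ≤ b
Max-square-≤ zero    f 0≤b f²≤b = 0≤b
Max-square-≤ (suc n) f 0≤b f²≤b with ⊔-sel (f zero) (Max n (f ∘ suc))
... | inj₁ eq rewrite eq = f²≤b zero
... | inj₂ eq rewrite eq = Max-square-≤ n (f ∘ suc) 0≤b (f²≤b ∘ suc)

Σ-squares≡0 : ∀ n (f : Fin n → ℚ) → Σ n (λ i → f i * f i) ≡ 0ℚ → ∀ i → f i ≡ 0ℚ
Σ-squares≡0 n f Σf²≡0 i =
  p*p≡0⇒p≡0 (f i) (≤-antisym (≤-trans (≤Σ n (λ j → 0≤p*p (f j)) i) (≤-reflexive Σf²≡0)) (0≤p*p (f i)))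

-- Lagrange's identity: Σᵢ Σⱼ (aᵢ - aⱼ)² = 2 n Σᵢ aᵢ² - 2 (Σᵢ aᵢ)².
Cauchy-Schwarz : ∀ n (a : Fin n → ℚ) → Σ n a * Σ n a ≤ fromℕ n * Σ n (λ i → a i * a i)
Cauchy-Schwarz n a =
  p+p≤q+q⇒p≤q (0≤q-p⇒p≤q (subst (0ℚ ≤_) lagrange (0≤Σ n (λ i → 0≤Σ n (λ j → 0≤p*p (a i - a j))))))
  where
  open ≡-Reasoning
  N = fromℕ n
  S = Σ n a
  S₂ = Σ n (λ i → a i * a i)

  square-of-difference : ∀ x y → (x - y) * (x - y) ≡ (x * x + y * y) - (x * y + x * y)
  square-of-difference = solve 2 (λ x y → (x :- y) :* (x :- y) := (x :* x :+ y :* y) :- (x :* y :+ x :* y)) refl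

  row : ∀ i → Σ n (λ j → (a i - a j) * (a i - a j)) ≡ (N * (a i * a i) + S₂) - (a i * S + a i * S)
  row i = begin
    Σ n (λ j → (a i - a j) * (a i - a j))                                    ≡⟨ Σ-cong n (λ j → square-of-difference (a i) (a j)) ⟩
    Σ n (λ j → (a i * a i + a j * a j) - (a i * a j + a i * a j))            ≡⟨ Σ-distrib-- n _ _ ⟩
    Σ n (λ j → a i * a i + a j * a j) - Σ n (λ j → a i * a j + a i * a j)    ≡⟨ cong₂ _-_ squares products ⟩
    (N * (a i * a i) + S₂) - (a i * S + a i * S)                             ∎
    where
    squares : Σ n (λ j → a i * a i + a j * a j) ≡ N * (a i * a i) + S₂
    squares = trans (Σ-distrib-+ n _ _) (cong (_+ S₂) (Σ-const n (a i * a i)))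

    products : Σ n (λ j → a i * a j + a i * a j) ≡ a i * S + a i * S
    products = trans (Σ-distrib-+ n _ _) (cong₂ _+_ (sym (*-distribˡ-Σ n (a i) a)) (sym (*-distribˡ-Σ n (a i) a)))

  lagrange : Σ n (λ i → Σ n (λ j → (a i - a j) * (a i - a j))) ≡ (N * S₂ + N * S₂) - (S * S + S * S)
  lagrange = begin
    Σ n (λ i → Σ n (λ j → (a i - a j) * (a i - a j)))                  ≡⟨ Σ-cong n row ⟩
    Σ n (λ i → (N * (a i * a i) + S₂) - (a i * S + a i * S))           ≡⟨ Σ-distrib-- n _ _ ⟩
    Σ n (λ i → N * (a i * a i) + S₂) - Σ n (λ i → a i * S + a i * S)   ≡⟨ cong₂ _-_ squares products ⟩
    (N * S₂ + N * S₂) - (S * S + S * S)                                ∎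
    where
    squares : Σ n (λ i → N * (a i * a i) + S₂) ≡ N * S₂ + N * S₂
    squares = trans (Σ-distrib-+ n _ _) (cong₂ _+_ (sym (*-distribˡ-Σ n N _)) (Σ-const n S₂))

    products : Σ n (λ i → a i * S + a i * S) ≡ S * S + S * S
    products = trans (Σ-distrib-+ n _ _) (cong₂ _+_ (sym (*-distribʳ-Σ n S a)) (sym (*-distribʳ-Σ n S a)))

infixl 6 _⊖_
_⊖_ : ∀ {a b} → Matrix a b → Matrix a b → Matrix a b
(M ⊖ N) i j = M i j - N i j

O : ∀ {a b} → Matrix a b
O i j = 0ℚ

≐-refl : ∀ {a b} {M : Matrix a b} → M ≐ M
≐-refl i j = refl

≐-trans : ∀ {a b} {M N K : Matrix a b} → M ≐ N → N ≐ K → M ≐ K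
≐-trans M≐N N≐K i j = trans (M≐N i j) (N≐K i j)

≐-sym : ∀ {a b} {M N : Matrix a b} → M ≐ N → N ≐ M
≐-sym M≐N i j = sym (M≐N i j)

≐-setoid : ℕ → ℕ → Setoid 0ℓ 0ℓ
≐-setoid a b = record
  { Carrier       = Matrix a b
  ; _≈_           = _≐_
  ; isEquivalence = record { refl = ≐-refl ; sym = ≐-sym ; trans = ≐-trans }
  }

module ≐-Reasoning {a b : ℕ} = SetoidReasoning (≐-setoid a b)

⊖-cong : ∀ {a b} {M M′ N N′ : Matrix a b} → M ≐ M′ → N ≐ N′ → M ⊖ N ≐ M′ ⊖ N′
⊖-cong M≐M′ N≐N′ i j = cong₂ _-_ (M≐M′ i j) (N≐N′ i j)

⊗-cong : ∀ {a b c} {M M′ : Matrix a b} {N N′ : Matrix b c} → M ≐ M′ → N ≐ N′ → M ⊗ N ≐ M′ ⊗ N′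
⊗-cong {b = b} M≐M′ N≐N′ i j = Σ-cong b (λ k → cong₂ _*_ (M≐M′ i k) (N≐N′ k j))

⊗-congˡ : ∀ {a b c} (M : Matrix a b) {N N′ : Matrix b c} → N ≐ N′ → M ⊗ N ≐ M ⊗ N′
⊗-congˡ M = ⊗-cong (≐-refl {M = M})

⊗-congʳ : ∀ {a b c} {M M′ : Matrix a b} (N : Matrix b c) → M ≐ M′ → M ⊗ N ≐ M′ ⊗ N
⊗-congʳ N M≐M′ = ⊗-cong M≐M′ (≐-refl {M = N})

⊗-assoc : ∀ {a b c d} (M : Matrix a b) (N : Matrix b c) (K : Matrix c d) → (M ⊗ N) ⊗ K ≐ M ⊗ (N ⊗ K)
⊗-assoc {b = b} {c = c} M N K i j = begin
  Σ c (λ l → Σ b (λ k → M i k * N k l) * K l j)   ≡⟨ Σ-cong c (λ l → *-distribʳ-Σ b (K l j) _) ⟩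
  Σ c (λ l → Σ b (λ k → M i k * N k l * K l j))   ≡⟨ Σ-comm c b _ ⟩
  Σ b (λ k → Σ c (λ l → M i k * N k l * K l j))   ≡⟨ Σ-cong b (λ k → Σ-cong c (λ l → *-assoc (M i k) _ _)) ⟩
  Σ b (λ k → Σ c (λ l → M i k * (N k l * K l j))) ≡⟨ Σ-cong b (λ k → *-distribˡ-Σ c (M i k) _) ⟨
  Σ b (λ k → M i k * Σ c (λ l → N k l * K l j))   ∎
  where open ≡-Reasoning

⊗-identityˡ : ∀ {a b} (M : Matrix a b) → W ⊗ M ≐ M
⊗-identityˡ {a} M i j = Σ-χˡ a i (λ k → M k j)

⊗-identityʳ : ∀ {a b} (M : Matrix a b) → M ⊗ W ≐ M
⊗-identityʳ {b = b} M i j = Σ-χʳ b j (M i)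

⊗-zeroʳ : ∀ {a b c} (M : Matrix a b) → M ⊗ O {b} {c} ≐ O
⊗-zeroʳ {b = b} M i j = Σ-zero b (λ k → *-zeroʳ (M i k))

⊗-distribˡ-⊖ : ∀ {a b c} (M : Matrix a b) (N K : Matrix b c) → M ⊗ (N ⊖ K) ≐ M ⊗ N ⊖ M ⊗ K
⊗-distribˡ-⊖ {b = b} M N K i j =
  trans (Σ-cong b (λ k → *-distribˡ-- (M i k) (N k j) (K k j))) (Σ-distrib-- b _ _)

⊖-inverse : ∀ {a b} (M : Matrix a b) → M ⊖ M ≐ O
⊖-inverse M i j = +-inverseʳ (M i j)

⊖≐O⇒≐ : ∀ {a b} {M N : Matrix a b} → M ⊖ N ≐ O → M ≐ N
⊖≐O⇒≐ M⊖N≐O i j = p-q≡0⇒p≡q (M⊖N≐O i j)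

transpose-cong : ∀ {a b} {M N : Matrix a b} → M ≐ N → transpose M ≐ transpose N
transpose-cong M≐N i j = M≐N j i

transpose-⊗ : ∀ {a b c} (M : Matrix a b) (N : Matrix b c) → transpose (M ⊗ N) ≐ transpose N ⊗ transpose M
transpose-⊗ {b = b} M N i j = Σ-cong b (λ k → *-comm (M j k) (N k i))

-- The diagonal of Mᵀ M consists of the squared lengths of the columns of M.
Mᵀ⊗M≐O⇒M≐O : ∀ {a b} (M : Matrix a b) → transpose M ⊗ M ≐ O → M ≐ O
Mᵀ⊗M≐O⇒M≐O {a} M MᵀM≐O i j = Σ-squares≡0 a (λ k → M k j) (MᵀM≐O j j) i

-- The first of the four Penrose conditions.
IsGeneralizedInverse : ∀ {n} → Matrix n n → Matrix n n → Set
IsGeneralizedInverse A Q = (A ⊗ Q) ⊗ A ≐ A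

ginv-transpose : ∀ {n} {A Q : Matrix n n} → transpose A ≐ A →
                 IsGeneralizedInverse A Q → IsGeneralizedInverse A (transpose Q)
ginv-transpose {A = A} {Q} Aᵀ≐A AQA≐A = begin
  (A ⊗ transpose Q) ⊗ A                       ≈⟨ ⊗-assoc A (transpose Q) A ⟩
  A ⊗ (transpose Q ⊗ A)                       ≈⟨ ⊗-cong Aᵀ≐A (⊗-congˡ (transpose Q) Aᵀ≐A) ⟨
  transpose A ⊗ (transpose Q ⊗ transpose A)   ≈⟨ ⊗-congˡ (transpose A) (transpose-⊗ A Q) ⟨
  transpose A ⊗ transpose (A ⊗ Q)             ≈⟨ transpose-⊗ (A ⊗ Q) A ⟨
  transpose ((A ⊗ Q) ⊗ A)                     ≈⟨ transpose-cong AQA≐A ⟩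
  transpose A                                 ≈⟨ Aᵀ≐A ⟩
  A                                           ∎
  where open ≐-Reasoning

divergence : ∀ {n m} → Graph n m → (Fin m → ℚ) → Fin n → ℚ
divergence {m = m} G f x = Σ m (λ e → grad G e x * f e)

col : ∀ {n} → (Fin n → ℚ) → Matrix n 1
col v i _ = v i

module _ {n m : ℕ} (G : Graph n m) where
  private
    B  = grad G
    Bᵀ = transpose (grad G)
    L  = Lap G

  Lap≐Bᵀ⊗B : L ≐ Bᵀ ⊗ B
  Lap≐Bᵀ⊗B = ⊗-congʳ B (⊗-identityʳ Bᵀ)

  Lap-symmetric : transpose L ≐ L
  Lap-symmetric = begin
    transpose L                    ≈⟨ transpose-cong Lap≐Bᵀ⊗B ⟩
    transpose (Bᵀ ⊗ B)             ≈⟨ transpose-⊗ Bᵀ B ⟩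
    Bᵀ ⊗ B                         ≈⟨ Lap≐Bᵀ⊗B ⟨
    L                              ∎
    where open ≐-Reasoning

  -- H = B Q L - B satisfies Bᵀ H = L Q L - L = 0, and H = B (Q L - I), so Hᵀ H = 0.
  grad⊗Q⊗Lap≐grad : ∀ {Q} → IsGeneralizedInverse L Q → (B ⊗ Q) ⊗ L ≐ B
  grad⊗Q⊗Lap≐grad {Q} LQL≐L = ⊖≐O⇒≐ (Mᵀ⊗M≐O⇒M≐O H HᵀH≐O)
    where
    open ≐-Reasoning
    H : Matrix m n
    H = (B ⊗ Q) ⊗ L ⊖ B

    BᵀBQL≐L : Bᵀ ⊗ ((B ⊗ Q) ⊗ L) ≐ L
    BᵀBQL≐L = begin
      Bᵀ ⊗ ((B ⊗ Q) ⊗ L)              ≈⟨ ⊗-assoc Bᵀ (B ⊗ Q) L ⟨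
      (Bᵀ ⊗ (B ⊗ Q)) ⊗ L              ≈⟨ ⊗-congʳ L (⊗-assoc Bᵀ B Q) ⟨
      ((Bᵀ ⊗ B) ⊗ Q) ⊗ L              ≈⟨ ⊗-congʳ L (⊗-congʳ Q Lap≐Bᵀ⊗B) ⟨
      (L ⊗ Q) ⊗ L                     ≈⟨ LQL≐L ⟩
      L                               ∎

    BᵀH≐O : Bᵀ ⊗ H ≐ O
    BᵀH≐O = begin
      Bᵀ ⊗ H                          ≈⟨ ⊗-distribˡ-⊖ Bᵀ ((B ⊗ Q) ⊗ L) B ⟩
      Bᵀ ⊗ ((B ⊗ Q) ⊗ L) ⊖ Bᵀ ⊗ B     ≈⟨ ⊖-cong BᵀBQL≐L (≐-sym Lap≐Bᵀ⊗B) ⟩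
      L ⊖ L                           ≈⟨ ⊖-inverse L ⟩
      O                               ∎

    H≐B⊗[QL-I] : H ≐ B ⊗ (Q ⊗ L ⊖ W)
    H≐B⊗[QL-I] = begin
      (B ⊗ Q) ⊗ L ⊖ B                 ≈⟨ ⊖-cong (⊗-assoc B Q L) (≐-sym (⊗-identityʳ B)) ⟩
      B ⊗ (Q ⊗ L) ⊖ B ⊗ W             ≈⟨ ⊗-distribˡ-⊖ B (Q ⊗ L) W ⟨
      B ⊗ (Q ⊗ L ⊖ W)                 ∎

    HᵀH≐O : transpose H ⊗ H ≐ O
    HᵀH≐O = begin
      transpose H ⊗ H                               ≈⟨ ⊗-congʳ H (transpose-cong H≐B⊗[QL-I]) ⟩
      transpose (B ⊗ (Q ⊗ L ⊖ W)) ⊗ H               ≈⟨ ⊗-congʳ H (transpose-⊗ B (Q ⊗ L ⊖ W)) ⟩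
      (transpose (Q ⊗ L ⊖ W) ⊗ Bᵀ) ⊗ H              ≈⟨ ⊗-assoc (transpose (Q ⊗ L ⊖ W)) Bᵀ H ⟩
      transpose (Q ⊗ L ⊖ W) ⊗ (Bᵀ ⊗ H)              ≈⟨ ⊗-congˡ (transpose (Q ⊗ L ⊖ W)) BᵀH≐O ⟩
      transpose (Q ⊗ L ⊖ W) ⊗ O                     ≈⟨ ⊗-zeroʳ (transpose (Q ⊗ L ⊖ W)) ⟩
      O                                             ∎

  Lap⊗Q⊗gradᵀ≐gradᵀ : ∀ {Q} → IsGeneralizedInverse L Q → L ⊗ (Q ⊗ Bᵀ) ≐ Bᵀ
  Lap⊗Q⊗gradᵀ≐gradᵀ {Q} LQL≐L = begin
    L ⊗ (Q ⊗ Bᵀ)                                ≈⟨ ⊗-cong Lap-symmetric (transpose-⊗ B (transpose Q)) ⟨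
    transpose L ⊗ transpose (B ⊗ transpose Q)   ≈⟨ transpose-⊗ (B ⊗ transpose Q) L ⟨
    transpose ((B ⊗ transpose Q) ⊗ L)           ≈⟨ transpose-cong (grad⊗Q⊗Lap≐grad (ginv-transpose Lap-symmetric LQL≐L)) ⟩
    Bᵀ                                          ∎
    where open ≐-Reasoning

potential : ∀ {n} → Matrix n n → (Fin n → ℚ) → Fin n → ℚ
potential {n} P d x = Σ n (λ y → P x y * d y)

electric-potential : ∀ {n m} (G : Graph n m) (P : Matrix n n) d e →
                     electric G P d e ≡ potential P d (proj₁ (edge G e)) - potential P d (proj₂ (edge G e))
electric-potential {n} {m} G P d e = begin
  electric G P d e                                          ≡⟨ Σ-χˡ m e (λ e′ → Σ n (λ x → grad G e′ x * φ x)) ⟩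
  Σ n (λ x → (χ u x - χ v x) * φ x)                         ≡⟨ Σ-cong n (λ x → *-distribʳ-- (χ u x) (χ v x) (φ x)) ⟩
  Σ n (λ x → χ u x * φ x - χ v x * φ x)                     ≡⟨ Σ-distrib-- n _ _ ⟩
  Σ n (λ x → χ u x * φ x) - Σ n (λ x → χ v x * φ x)         ≡⟨ cong₂ _-_ (Σ-χˡ n u φ) (Σ-χˡ n v φ) ⟩
  φ u - φ v                                                 ∎
  where
  open ≡-Reasoning
  φ = potential P d
  u = proj₁ (edge G e)
  v = proj₂ (edge G e)

module Electric {n m : ℕ} (G : Graph n m) (P : Matrix n n) (LPL≐L : IsGeneralizedInverse (Lap G) P) where
  private
    B  = grad G
    Bᵀ = transpose (grad G)

  Π : Matrix m m
  Π = (B ⊗ P) ⊗ Bᵀ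

  electric≡Π⊗flow : ∀ {f d} → Routes G f d → ∀ e → electric G P d e ≡ Σ m (λ e′ → Π e e′ * f e′)
  electric≡Π⊗flow {f} {d} Bᵀf≡d e = W⊗B⊗P⊗d≐Π⊗f e zero
    where
    open ≐-Reasoning
    W⊗B⊗P⊗d≐Π⊗f : W ⊗ (B ⊗ (P ⊗ col d)) ≐ Π ⊗ col f
    W⊗B⊗P⊗d≐Π⊗f = begin
      W ⊗ (B ⊗ (P ⊗ col d))    ≈⟨ ⊗-identityˡ (B ⊗ (P ⊗ col d)) ⟩
      B ⊗ (P ⊗ col d)          ≈⟨ ⊗-congˡ B (⊗-congˡ P (λ x _ → Bᵀf≡d x)) ⟨
      B ⊗ (P ⊗ (Bᵀ ⊗ col f))   ≈⟨ ⊗-congˡ B (⊗-assoc P Bᵀ (col f)) ⟨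
      B ⊗ ((P ⊗ Bᵀ) ⊗ col f)   ≈⟨ ⊗-assoc B (P ⊗ Bᵀ) (col f) ⟨
      (B ⊗ (P ⊗ Bᵀ)) ⊗ col f   ≈⟨ ⊗-congʳ (col f) (⊗-assoc B P Bᵀ) ⟨
      Π ⊗ col f                ∎

  gradᵀ⊗Π≐gradᵀ : Bᵀ ⊗ Π ≐ Bᵀ
  gradᵀ⊗Π≐gradᵀ = begin
    Bᵀ ⊗ ((B ⊗ P) ⊗ Bᵀ)      ≈⟨ ⊗-congˡ Bᵀ (⊗-assoc B P Bᵀ) ⟩
    Bᵀ ⊗ (B ⊗ (P ⊗ Bᵀ))      ≈⟨ ⊗-assoc Bᵀ B (P ⊗ Bᵀ) ⟨
    (Bᵀ ⊗ B) ⊗ (P ⊗ Bᵀ)      ≈⟨ ⊗-congʳ (P ⊗ Bᵀ) (Lap≐Bᵀ⊗B G) ⟨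
    Lap G ⊗ (P ⊗ Bᵀ)         ≈⟨ Lap⊗Q⊗gradᵀ≐gradᵀ G LPL≐L ⟩
    Bᵀ                       ∎
    where open ≐-Reasoning

  electric-routes : ∀ {f d} → Routes G f d → Routes G (electric G P d) d
  electric-routes {f} {d} Bᵀf≡d x = begin
    divergence G (electric G P d) x                  ≡⟨ Σ-cong m (λ e → cong (grad G e x *_) (electric≡Π⊗flow Bᵀf≡d e)) ⟩
    (Bᵀ ⊗ (Π ⊗ col f)) x zero                        ≡⟨ ⊗-assoc Bᵀ Π (col f) x zero ⟨
    ((Bᵀ ⊗ Π) ⊗ col f) x zero                        ≡⟨ ⊗-congʳ (col f) gradᵀ⊗Π≐gradᵀ x zero ⟩
    divergence G f x                                 ≡⟨ Bᵀf≡d x ⟩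
    d x                                              ∎
    where open ≡-Reasoning

  Π⊗Πᵀ≐Πᵀ : Π ⊗ transpose Π ≐ transpose Π
  Π⊗Πᵀ≐Πᵀ = begin
    Π ⊗ transpose Π                ≈⟨ ⊗-congˡ Π Πᵀ≐B⊗X ⟩
    Π ⊗ (B ⊗ X)                    ≈⟨ ⊗-assoc Π B X ⟨
    (Π ⊗ B) ⊗ X                    ≈⟨ ⊗-congʳ X Π⊗B≐B ⟩
    B ⊗ X                          ≈⟨ Πᵀ≐B⊗X ⟨
    transpose Π                    ∎
    where
    open ≐-Reasoning
    X = transpose P ⊗ Bᵀ

    Πᵀ≐B⊗X : transpose Π ≐ B ⊗ X
    Πᵀ≐B⊗X = ≐-trans (transpose-⊗ (B ⊗ P) Bᵀ) (⊗-congˡ B (transpose-⊗ B P))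

    Π⊗B≐B : Π ⊗ B ≐ B
    Π⊗B≐B = begin
      ((B ⊗ P) ⊗ Bᵀ) ⊗ B       ≈⟨ ⊗-assoc (B ⊗ P) Bᵀ B ⟩
      (B ⊗ P) ⊗ (Bᵀ ⊗ B)       ≈⟨ ⊗-congˡ (B ⊗ P) (Lap≐Bᵀ⊗B G) ⟨
      (B ⊗ P) ⊗ Lap G          ≈⟨ grad⊗Q⊗Lap≐grad G LPL≐L ⟩
      B                        ∎

  -- The diagonal entry Πₑₑ equals the squared length of row e, and bounds its own square.
  Σ-Π²≤1 : ∀ e → Σ m (λ e′ → Π e e′ * Π e e′) ≤ 1ℚ
  Σ-Π²≤1 e = p*p≤p⇒p≤1 (subst (λ x → x * x ≤ Σ m (λ e′ → Π e e′ * Π e e′)) (sym (Π⊗Πᵀ≐Πᵀ e e))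
                                 (≤Σ m (λ e′ → 0≤p*p (Π e e′)) e))

  Σ∣Π∣²≤m : ∀ e → Σ m (λ e′ → ∣ Π e e′ ∣) * Σ m (λ e′ → ∣ Π e e′ ∣) ≤ fromℕ m
  Σ∣Π∣²≤m e = begin
    Σ m (λ e′ → ∣ Π e e′ ∣) * Σ m (λ e′ → ∣ Π e e′ ∣)   ≤⟨ Cauchy-Schwarz m (λ e′ → ∣ Π e e′ ∣) ⟩
    fromℕ m * Σ m (λ e′ → ∣ Π e e′ ∣ * ∣ Π e e′ ∣)      ≡⟨ cong (fromℕ m *_) (Σ-cong m (∣p∣*∣p∣≡p*p ∘ Π e)) ⟩
    fromℕ m * Σ m (λ e′ → Π e e′ * Π e e′)              ≤⟨ *-monoˡ-≤-nonNeg (fromℕ m) (Σ-Π²≤1 e) ⟩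
    fromℕ m * 1ℚ                                        ≡⟨ *-identityʳ (fromℕ m) ⟩
    fromℕ m                                             ∎
    where
    open ≤-Reasoning
    ∣p∣*∣p∣≡p*p : ∀ p → ∣ p ∣ * ∣ p ∣ ≡ p * p
    ∣p∣*∣p∣≡p*p p = trans (sym (∣p*q∣≡∣p∣*∣q∣ p p)) (0≤p⇒∣p∣≡p (0≤p*p p))

  electric-congestion²≤m*congestion² : ∀ {k} (D : DemandSet n k) (F : Fin k → Fin m → ℚ) → RoutesSet G D F →
                         congestion (electricSet G P D) * congestion (electricSet G P D)
                           ≤ fromℕ m * (congestion F * congestion F)
  electric-congestion²≤m*congestion² {k} D F routes =
    Max-square-≤ m load (0≤p*q (0≤fromℕ m) (0≤p*p c)) load²≤m*c²
    where
    open ≤-Reasoning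
    c = congestion F

    A : Fin m → ℚ
    A e = Σ m (λ e′ → ∣ Π e e′ ∣)

    load : Fin m → ℚ
    load e = Σ k (λ τ → ∣ electricSet G P D τ e ∣)

    load≤A*c : ∀ e → load e ≤ A e * c
    load≤A*c e = begin
      Σ k (λ τ → ∣ electricSet G P D τ e ∣)
        ≡⟨ Σ-cong k (λ τ → cong ∣_∣ (electric≡Π⊗flow (routes τ) e)) ⟩
      Σ k (λ τ → ∣ Σ m (λ e′ → Π e e′ * F τ e′) ∣)
        ≤⟨ Σ-mono-≤ k (λ τ → ∣Σ∣≤Σ∣∣ m (λ e′ → Π e e′ * F τ e′)) ⟩
      Σ k (λ τ → Σ m (λ e′ → ∣ Π e e′ * F τ e′ ∣))
        ≡⟨ Σ-comm k m (λ τ e′ → ∣ Π e e′ * F τ e′ ∣) ⟩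
      Σ m (λ e′ → Σ k (λ τ → ∣ Π e e′ * F τ e′ ∣))
        ≡⟨ Σ-cong m (λ e′ → Σ-cong k (λ τ → ∣p*q∣≡∣p∣*∣q∣ (Π e e′) (F τ e′))) ⟩
      Σ m (λ e′ → Σ k (λ τ → ∣ Π e e′ ∣ * ∣ F τ e′ ∣))
        ≡⟨ Σ-cong m (λ e′ → *-distribˡ-Σ k ∣ Π e e′ ∣ (λ τ → ∣ F τ e′ ∣)) ⟨
      Σ m (λ e′ → ∣ Π e e′ ∣ * Σ k (λ τ → ∣ F τ e′ ∣))
        ≤⟨ Σ-mono-≤ m (λ e′ → *-monoˡ-≤-nonNeg ∣ Π e e′ ∣ {{∣-∣-nonNeg (Π e e′)}} (F-load≤c e′)) ⟩
      Σ m (λ e′ → ∣ Π e e′ ∣ * c)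
        ≡⟨ *-distribʳ-Σ m c (λ e′ → ∣ Π e e′ ∣) ⟨
      A e * c
        ∎
      where
      F-load≤c : ∀ e′ → Σ k (λ τ → ∣ F τ e′ ∣) ≤ c
      F-load≤c = ≤-Max m (λ e′ → Σ k (λ τ → ∣ F τ e′ ∣))

    load²≤m*c² : ∀ e → load e * load e ≤ fromℕ m * (c * c)
    load²≤m*c² e = begin
      load e * load e            ≤⟨ p≤q⇒p*p≤q*q (0≤Σ k (λ τ → 0≤∣p∣ _)) (load≤A*c e) ⟩
      (A e * c) * (A e * c)      ≡⟨ *-interchange (A e) c (A e) c ⟩
      (A e * A e) * (c * c)      ≤⟨ *-monoʳ-≤-nonNeg (c * c) {{nonNegative (0≤p*p c)}} (Σ∣Π∣²≤m e) ⟩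
      fromℕ m * (c * c)          ∎

reach-trans : ∀ {n m} {G : Graph n m} {x y z} → Reach G x y → Reach G y z → Reach G x z
reach-trans here        y⇝z = y⇝z
reach-trans (fwd e x⇝y) y⇝z = fwd e (reach-trans x⇝y y⇝z)
reach-trans (bwd e x⇝y) y⇝z = bwd e (reach-trans x⇝y y⇝z)

reach-sym : ∀ {n m} {G : Graph n m} {x y} → Reach G x y → Reach G y x
reach-sym here        = here
reach-sym (fwd e x⇝y) = reach-trans (reach-sym x⇝y) (bwd e here)
reach-sym (bwd e x⇝y) = reach-trans (reach-sym x⇝y) (fwd e here)

reach-bwd : ∀ {n m} {G : Graph n m} e {u v x} → edge G e ≡ (u , v) → Reach G u x → Reach G v x
reach-bwd e refl = bwd e

-- The theta graph: k internally disjoint paths of length ℓ + 1 between s and t, plus the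
-- chord s t.  Taking ℓ = suc i keeps every path from being parallel to the chord.
module Theta (k i : ℕ) where
  ℓ nV nE : ℕ
  ℓ  = suc i
  nV = suc (suc (k ℕ.* ℓ))
  nE = suc (k ℕ.* suc ℓ)

  s t : Fin nV
  s = zero
  t = suc zero

  node : Fin k → Fin ℓ → Fin nV
  node j p = suc (suc (combine j p))

  pathVertex : Fin k → Fin (suc (suc ℓ)) → Fin nV
  pathVertex j zero    = s
  pathVertex j (suc q) with view q
  ... | ‵fromℕ     = t
  ... | ‵inject₁ p = node j p

  pathSource pathTarget : Fin k → Fin (suc ℓ) → Fin nV
  pathSource j q = pathVertex j (inject₁ q)
  pathTarget j q = pathVertex j (suc q)

  pathEnds : Fin k × Fin (suc ℓ) → Fin nV × Fin nV
  pathEnds (j , q) = pathSource j q , pathTarget j q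

  ends : Fin nE → Fin nV × Fin nV
  ends zero    = s , t
  ends (suc y) = pathEnds (remQuot {k} (suc ℓ) y)

  chord : Fin nE
  chord = zero

  pathEdge : Fin k → Fin (suc ℓ) → Fin nE
  pathEdge j q = suc (combine j q)

  ends-pathEdge : ∀ j q → ends (pathEdge j q) ≡ pathEnds (j , q)
  ends-pathEdge j q = cong pathEnds (Finₚ.remQuot-combine j q)

  pathVertex-inject₁ : ∀ j p → pathVertex j (suc (inject₁ p)) ≡ node j p
  pathVertex-inject₁ j p rewrite view-inject₁ p = refl

  pathVertex-last : ∀ j → pathVertex j (Fin.fromℕ (suc ℓ)) ≡ t
  pathVertex-last j rewrite view-fromℕ ℓ = refl

  node-injective : ∀ {j p j′ p′} → node j p ≡ node j′ p′ → j ≡ j′ × p ≡ p′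
  node-injective eq = Finₚ.combine-injective _ _ _ _ (Finₚ.suc-injective (Finₚ.suc-injective eq))

  -- The position of a vertex on its path.  Path edges increase it by exactly one, which
  -- rules out loops and parallel edges.
  depth : Fin nV → ℕ
  depth zero          = 0
  depth (suc zero)    = suc ℓ
  depth (suc (suc x)) = suc (toℕ (proj₂ (remQuot {k} ℓ x)))

  depth-pathVertex : ∀ j r → depth (pathVertex j r) ≡ toℕ r
  depth-pathVertex j zero    = refl
  depth-pathVertex j (suc q) with view q
  ... | ‵fromℕ     = cong suc (sym (Finₚ.toℕ-fromℕ ℓ))
  ... | ‵inject₁ p = cong suc (trans (cong (toℕ ∘ proj₂) (Finₚ.remQuot-combine {k} {ℓ} j p)) (sym (Finₚ.toℕ-inject₁ p)))

  pathVertex-position : ∀ {j j′ r r′} → pathVertex j r ≡ pathVertex j′ r′ → r ≡ r′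
  pathVertex-position {j} {j′} {r} {r′} eq =
    Finₚ.toℕ-injective (trans (sym (depth-pathVertex j r)) (trans (cong depth eq) (depth-pathVertex j′ r′)))

  pathVertex≡node : ∀ {j r j₀ p₀} → pathVertex j r ≡ node j₀ p₀ → j ≡ j₀ × r ≡ suc (inject₁ p₀)
  pathVertex≡node {j} {r} {j₀} {p₀} eq = proj₁ (node-injective node-j) , r≡
    where
    r≡ : r ≡ suc (inject₁ p₀)
    r≡ = pathVertex-position (trans eq (sym (pathVertex-inject₁ j₀ p₀)))
    node-j : node j p₀ ≡ node j₀ p₀
    node-j = trans (sym (pathVertex-inject₁ j p₀)) (trans (cong (pathVertex j) (sym r≡)) eq)

  pathVertex≡s : ∀ {j r} → pathVertex j r ≡ s → r ≡ zero
  pathVertex≡s {j} {r} = pathVertex-position {j} {j} {r} {zero}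

  pathVertex≡t : ∀ {j r} → pathVertex j r ≡ t → r ≡ Fin.fromℕ (suc ℓ)
  pathVertex≡t {j} {r} eq = pathVertex-position {j} {j} {r} (trans eq (sym (pathVertex-last j)))

  pathVertex≢node : ∀ {j r j₀ p₀} → j ≢ j₀ → pathVertex j r ≢ node j₀ p₀
  pathVertex≢node {j} {r} j≢j₀ eq = j≢j₀ (proj₁ (pathVertex≡node {j} {r} eq))

  Ascending : Fin nV × Fin nV → Set
  Ascending (u , v) = depth v ≡ suc (depth u)

  pathEnds-ascending : ∀ x → Ascending (pathEnds x)
  pathEnds-ascending (j , q) =
    trans (depth-pathVertex j (suc q)) (cong suc (sym (trans (depth-pathVertex j (inject₁ q)) (Finₚ.toℕ-inject₁ q))))

  ascending-irreversible : ∀ {u v} → Ascending (u , v) → ¬ Ascending (v , u)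
  ascending-irreversible {u} {v} u↗v v↗u = ℕₚ.m+1+n≢n 1 {depth u} (sym (trans v↗u (cong suc u↗v)))

  pathEnds-injective : ∀ x x′ → pathEnds x ≡ pathEnds x′ → x ≡ x′
  pathEnds-injective (j , q) (j′ , q′) eq = cong₂ _,_ j≡j′ (Finₚ.inject₁-injective (pathVertex-position (cong proj₁ eq)))
    where
    j≡j′ : j ≡ j′
    j≡j′ with view q
    ... | ‵inject₁ p = sym (proj₁ (pathVertex≡node (sym (cong proj₂ eq))))
    ... | ‵fromℕ     = sym (proj₁ (pathVertex≡node {j′} {inject₁ q′} (trans (sym (cong proj₁ eq)) (pathVertex-inject₁ j (Fin.fromℕ i)))))

  ¬ascending-st : ¬ Ascending (s , t)
  ¬ascending-st ()

  ¬ascending-ts : ¬ Ascending (t , s)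
  ¬ascending-ts ()

  noLoop-ends : ∀ e → proj₁ (ends e) ≢ proj₂ (ends e)
  noLoop-ends zero    ()
  noLoop-ends (suc y) u≡v = ℕₚ.1+n≢n (sym (trans (cong depth u≡v) (pathEnds-ascending (remQuot {k} (suc ℓ) y))))

  simple-ends : ∀ e e′ → (ends e ≡ ends e′ ⊎ ends e ≡ swap (ends e′)) → e ≡ e′
  simple-ends zero    zero     _         = refl
  simple-ends zero    (suc y′) (inj₁ eq) = ⊥-elim (¬ascending-st (subst Ascending (sym eq) (pathEnds-ascending _)))
  simple-ends zero    (suc y′) (inj₂ eq) = ⊥-elim (¬ascending-ts (subst Ascending (sym (cong swap eq)) (pathEnds-ascending _)))
  simple-ends (suc y) zero     (inj₁ eq) = ⊥-elim (¬ascending-st (subst Ascending eq (pathEnds-ascending _)))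
  simple-ends (suc y) zero     (inj₂ eq) = ⊥-elim (¬ascending-ts (subst Ascending eq (pathEnds-ascending _)))
  simple-ends (suc y) (suc y′) (inj₁ eq) = cong suc (begin
    y                                         ≡⟨ Finₚ.combine-remQuot {k} (suc ℓ) y ⟨
    uncurry combine (remQuot {k} (suc ℓ) y)   ≡⟨ cong (uncurry combine) (pathEnds-injective _ _ eq) ⟩
    uncurry combine (remQuot {k} (suc ℓ) y′)  ≡⟨ Finₚ.combine-remQuot {k} (suc ℓ) y′ ⟩
    y′                                        ∎)
    where open ≡-Reasoning
  simple-ends (suc y) (suc y′) (inj₂ eq) =
    ⊥-elim (ascending-irreversible (pathEnds-ascending _) (subst Ascending eq (pathEnds-ascending _)))

  Gr : Graph nV nE
  Gr = record { edge = ends ; noLoop = noLoop-ends ; simple = simple-ends }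

  vertex-cases : (Q : Fin nV → Set) → Q s → Q t → (∀ j p → Q (node j p)) → ∀ x → Q x
  vertex-cases Q Qs Qt Qnode zero          = Qs
  vertex-cases Q Qs Qt Qnode (suc zero)    = Qt
  vertex-cases Q Qs Qt Qnode (suc (suc y)) with Finₚ.combine-surjective {k} {ℓ} y
  ... | j , p , refl = Qnode j p

  connected : Connected Gr
  connected x y = reach-trans (reach-s x) (reach-sym (reach-s y))
    where
    along : ∀ j r → Reach Gr (pathVertex j r) s
    along j = <-weakInduction (λ r → Reach Gr (pathVertex j r) s) here
                              (λ q → reach-bwd (pathEdge j q) (ends-pathEdge j q))

    reach-s : ∀ x → Reach Gr x s
    reach-s = vertex-cases (λ x → Reach Gr x s) here (bwd chord here)
                (λ j p → subst (λ x → Reach Gr x s) (pathVertex-inject₁ j p) (along j (suc (inject₁ p))))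

  Σ-edges : (h : Fin nE → ℚ) → Σ nE h ≡ h chord + Σ k (λ j → Σ (suc ℓ) (λ q → h (pathEdge j q)))
  Σ-edges h = cong (_+_ (h chord)) (Σ-combine k (suc ℓ) (h ∘ suc))

  pathOutflow pathInflow : (Fin nE → ℚ) → Fin nV → ℚ
  pathOutflow f x = Σ k (λ j → Σ (suc ℓ) (λ q → χ (pathSource j q) x * f (pathEdge j q)))
  pathInflow  f x = Σ k (λ j → Σ (suc ℓ) (λ q → χ (pathTarget j q) x * f (pathEdge j q)))

  divergence-Gr : ∀ f x → divergence Gr f x ≡ (χ s x - χ t x) * f chord + (pathOutflow f x - pathInflow f x)
  divergence-Gr f x = trans (Σ-edges (λ e → grad Gr e x * f e)) (cong (_+_ ((χ s x - χ t x) * f chord)) paths)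
    where
    out in′ : Fin k → Fin (suc ℓ) → ℚ
    out j q = χ (pathSource j q) x * f (pathEdge j q)
    in′ j q = χ (pathTarget j q) x * f (pathEdge j q)

    edge-term : ∀ j q → grad Gr (pathEdge j q) x * f (pathEdge j q) ≡ out j q - in′ j q
    edge-term j q = trans (cong (λ (u , v) → (χ u x - χ v x) * f (pathEdge j q)) (ends-pathEdge j q))
                          (*-distribʳ-- (χ (pathSource j q) x) (χ (pathTarget j q) x) (f (pathEdge j q)))

    paths : Σ k (λ j → Σ (suc ℓ) (λ q → grad Gr (pathEdge j q) x * f (pathEdge j q))) ≡ pathOutflow f x - pathInflow f x
    paths = trans (Σ-cong k (λ j → trans (Σ-cong (suc ℓ) (edge-term j)) (Σ-distrib-- (suc ℓ) (out j) (in′ j))))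
                  (Σ-distrib-- k _ _)

  pathOutflow-s : ∀ f → pathOutflow f s ≡ Σ k (λ j → f (pathEdge j zero))
  pathOutflow-s f = Σ-cong k (λ j → Σ-χ-single (suc ℓ) (pathSource j) (f ∘ pathEdge j) zero refl
                                      (λ q eq → Finₚ.inject₁-injective (pathVertex≡s {j} eq)))

  pathInflow-s : ∀ f → pathInflow f s ≡ 0ℚ
  pathInflow-s f = Σ-zero k (λ j → Σ-χ-none (suc ℓ) (pathTarget j) (f ∘ pathEdge j)
                                     (λ q eq → Finₚ.0≢1+n (sym (pathVertex≡s {j} eq))))

  pathOutflow-t : ∀ f → pathOutflow f t ≡ 0ℚ
  pathOutflow-t f = Σ-zero k (λ j → Σ-χ-none (suc ℓ) (pathSource j) (f ∘ pathEdge j)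
                                      (λ q eq → Finₚ.fromℕ≢inject₁ (sym (pathVertex≡t {j} {inject₁ q} eq))))

  pathInflow-t : ∀ f → pathInflow f t ≡ Σ k (λ j → f (pathEdge j (Fin.fromℕ ℓ)))
  pathInflow-t f = Σ-cong k (λ j → Σ-χ-single (suc ℓ) (pathTarget j) (f ∘ pathEdge j) (Fin.fromℕ ℓ) (pathVertex-last j)
                                     (λ q eq → Finₚ.suc-injective (pathVertex≡t {j} eq)))

  pathOutflow-node : ∀ f j p → pathOutflow f (node j p) ≡ f (pathEdge j (suc p))
  pathOutflow-node f j₀ p₀ =
    trans (Σ-single k j₀ (λ j j≢j₀ → Σ-χ-none (suc ℓ) (pathSource j) (f ∘ pathEdge j) (λ q → pathVertex≢node {r = inject₁ q} j≢j₀)))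
          (Σ-χ-single (suc ℓ) (pathSource j₀) (f ∘ pathEdge j₀) (suc p₀) (pathVertex-inject₁ j₀ p₀)
                      (λ q eq → Finₚ.inject₁-injective (proj₂ (pathVertex≡node {j₀} {inject₁ q} eq))))

  pathInflow-node : ∀ f j p → pathInflow f (node j p) ≡ f (pathEdge j (inject₁ p))
  pathInflow-node f j₀ p₀ =
    trans (Σ-single k j₀ (λ j j≢j₀ → Σ-χ-none (suc ℓ) (pathTarget j) (f ∘ pathEdge j) (λ q → pathVertex≢node {r = suc q} j≢j₀)))
          (Σ-χ-single (suc ℓ) (pathTarget j₀) (f ∘ pathEdge j₀) (inject₁ p₀) (pathVertex-inject₁ j₀ p₀)
                      (λ q eq → Finₚ.suc-injective (proj₂ (pathVertex≡node {j₀} {suc q} eq))))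

  divergence-s : ∀ f → divergence Gr f s ≡ f chord + Σ k (λ j → f (pathEdge j zero))
  divergence-s f = begin
    divergence Gr f s
      ≡⟨ divergence-Gr f s ⟩
    1ℚ * f chord + (pathOutflow f s - pathInflow f s)
      ≡⟨ cong₂ (λ a b → 1ℚ * f chord + (a - b)) (pathOutflow-s f) (pathInflow-s f) ⟩
    1ℚ * f chord + (Σ k (λ j → f (pathEdge j zero)) - 0ℚ)
      ≡⟨ cong₂ _+_ (*-identityˡ (f chord)) (+-identityʳ _) ⟩
    f chord + Σ k (λ j → f (pathEdge j zero))
      ∎
    where open ≡-Reasoning

  divergence-t : ∀ f → divergence Gr f t ≡ - (f chord + Σ k (λ j → f (pathEdge j (Fin.fromℕ ℓ))))
  divergence-t f = begin
    divergence Gr f t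
      ≡⟨ divergence-Gr f t ⟩
    (0ℚ - 1ℚ) * f chord + (pathOutflow f t - pathInflow f t)
      ≡⟨ cong₂ (λ a b → (0ℚ - 1ℚ) * f chord + (a - b)) (pathOutflow-t f) (pathInflow-t f) ⟩
    (0ℚ - 1ℚ) * f chord + (0ℚ - Σ k (λ j → f (pathEdge j (Fin.fromℕ ℓ))))
      ≡⟨ [0-1]a+[0-b]≡-[a+b] (f chord) _ ⟩
    - (f chord + Σ k (λ j → f (pathEdge j (Fin.fromℕ ℓ))))
      ∎
    where
    open ≡-Reasoning
    [0-1]a+[0-b]≡-[a+b] : ∀ a b → (0ℚ - 1ℚ) * a + (0ℚ - b) ≡ - (a + b)
    [0-1]a+[0-b]≡-[a+b] = solve 2 (λ a b → (con 0ℚ :- con 1ℚ) :* a :+ (con 0ℚ :- b) := :- (a :+ b)) refl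

  divergence-node : ∀ f j p → divergence Gr f (node j p) ≡ f (pathEdge j (suc p)) - f (pathEdge j (inject₁ p))
  divergence-node f j p = begin
    divergence Gr f (node j p)
      ≡⟨ divergence-Gr f (node j p) ⟩
    0ℚ * f chord + (pathOutflow f (node j p) - pathInflow f (node j p))
      ≡⟨ cong₂ (λ a b → 0ℚ * f chord + (a - b)) (pathOutflow-node f j p) (pathInflow-node f j p) ⟩
    0ℚ * f chord + Δ
      ≡⟨ trans (cong (_+ Δ) (*-zeroˡ (f chord))) (+-identityˡ Δ) ⟩
    Δ
      ∎
    where
    open ≡-Reasoning
    Δ = f (pathEdge j (suc p)) - f (pathEdge j (inject₁ p))

  unit : Demand nV
  unit = record { amount = 1ℚ ; pos = positive⁻¹ 1ℚ ; src = s ; snk = t ; distinct = λ () }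

  uniform : Fin nE → ℚ
  uniform _ = 1/ fromℕ (suc k)

  uniform-routes : Routes Gr uniform (demandVec unit)
  uniform-routes = vertex-cases (λ x → divergence Gr uniform x ≡ demandVec unit x)
    (trans (divergence-s uniform) r+k*r≡1)
    (trans (divergence-t uniform) (cong -_ r+k*r≡1))
    (λ j p → trans (divergence-node uniform j p) (+-inverseʳ r))
    where
    r = 1/ fromℕ (suc k)
    r+k*r≡1 : r + Σ k (λ _ → r) ≡ 1ℚ
    r+k*r≡1 = trans (Σ-const (suc k) r) (*-inverseʳ (fromℕ (suc k)))

  -- Flow conservation makes f constant along each path, and telescoping the potential
  -- along path j shows that its ℓ + 1 edges together carry f chord = φ s - φ t.
  potential-flow-on-chord : ∀ {f} (φ : Fin nV → ℚ) → Routes Gr f (demandVec unit) →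
                        (∀ e → f e ≡ φ (proj₁ (ends e)) - φ (proj₂ (ends e))) →
                        (fromℕ (suc ℓ) + fromℕ k) * f chord ≡ fromℕ (suc ℓ)
  potential-flow-on-chord {f} φ routes f≡∇φ = begin
    (L + fromℕ k) * c                              ≡⟨ *-distribʳ-+ c L (fromℕ k) ⟩
    L * c + fromℕ k * c                            ≡⟨ cong (_+_ (L * c)) (Σ-const k c) ⟨
    L * c + Σ k (λ _ → c)                          ≡⟨ cong (_+_ (L * c)) (Σ-cong k per-path) ⟨
    L * c + Σ k (λ j → L * f (pathEdge j zero))    ≡⟨ cong (_+_ (L * c)) (*-distribˡ-Σ k L (λ j → f (pathEdge j zero))) ⟨
    L * c + L * Σ k (λ j → f (pathEdge j zero))    ≡⟨ *-distribˡ-+ L c _ ⟨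
    L * (c + Σ k (λ j → f (pathEdge j zero)))      ≡⟨ cong (L *_) (trans (sym (divergence-s f)) (routes s)) ⟩
    L * 1ℚ                                         ≡⟨ *-identityʳ L ⟩
    L                                              ∎
    where
    open ≡-Reasoning
    L = fromℕ (suc ℓ)
    c = f chord

    constant-along-path : ∀ j q → f (pathEdge j q) ≡ f (pathEdge j zero)
    constant-along-path j = <-weakInduction (λ q → f (pathEdge j q) ≡ f (pathEdge j zero)) refl
      (λ p fp≡f0 → trans (p-q≡0⇒p≡q (trans (sym (divergence-node f j p)) (routes (node j p)))) fp≡f0)

    per-path : ∀ j → L * f (pathEdge j zero) ≡ c
    per-path j = begin
      L * f (pathEdge j zero)                                                ≡⟨ Σ-const (suc ℓ) (f (pathEdge j zero)) ⟨
      Σ (suc ℓ) (λ _ → f (pathEdge j zero))                                  ≡⟨ Σ-cong (suc ℓ) (constant-along-path j) ⟨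
      Σ (suc ℓ) (λ q → f (pathEdge j q))                                     ≡⟨ Σ-cong (suc ℓ) potential-drop ⟩
      Σ (suc ℓ) (λ q → φ (pathVertex j (inject₁ q)) - φ (pathVertex j (suc q))) ≡⟨ Σ-telescope (suc ℓ) (φ ∘ pathVertex j) ⟩
      φ s - φ (pathVertex j (Fin.fromℕ (suc ℓ)))                             ≡⟨ cong (λ v → φ s - φ v) (pathVertex-last j) ⟩
      φ s - φ t                                                              ≡⟨ f≡∇φ chord ⟨
      c                                                                      ∎
      where
      potential-drop : ∀ q → f (pathEdge j q) ≡ φ (pathVertex j (inject₁ q)) - φ (pathVertex j (suc q))
      potential-drop q = trans (f≡∇φ (pathEdge j q)) (cong (λ (u , v) → φ u - φ v) (ends-pathEdge j q))

[p+p]*q≡p⇒q≡½ : ∀ p .{{_ : NonZero p}} q → (p + p) * q ≡ p → q ≡ ½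
[p+p]*q≡p⇒q≡½ p q [p+p]q≡p = begin
  q                       ≡⟨ q≡[q+q]*½ q ⟩
  (q + q) * ½             ≡⟨ cong (_* ½) q+q≡1 ⟩
  1ℚ * ½                  ≡⟨ *-identityˡ ½ ⟩
  ½                       ∎
  where
  open ≡-Reasoning
  q≡[q+q]*½ : ∀ q → q ≡ (q + q) * ½
  q≡[q+q]*½ = solve 1 (λ q → q := (q :+ q) :* con ½) refl
  [p+p]*q≡p*[q+q] : ∀ p q → (p + p) * q ≡ p * (q + q)
  [p+p]*q≡p*[q+q] = solve 2 (λ p q → (p :+ p) :* q := p :* (q :+ q)) refl
  q+q≡1 : q + q ≡ 1ℚ
  q+q≡1 = begin
    q + q                   ≡⟨ *-identityˡ (q + q) ⟨
    1ℚ * (q + q)            ≡⟨ cong (_* (q + q)) (*-inverseˡ p) ⟨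
    (1/ p * p) * (q + q)    ≡⟨ *-assoc (1/ p) p (q + q) ⟩
    1/ p * (p * (q + q))    ≡⟨ cong (1/ p *_) (trans (sym ([p+p]*q≡p*[q+q] p q)) [p+p]q≡p) ⟩
    1/ p * p                ≡⟨ *-inverseˡ p ⟩
    1ℚ                      ∎

-- k = ℓ + 1 paths of length ℓ + 1: the chord carries half of the electric flow.
module BalancedTheta (i : ℕ) where
  open Theta (suc (suc i)) i public

  D : DemandSet nV 1
  D _ = unit

  F : Fin 1 → Fin nE → ℚ
  F _ = uniform

  F-routes : RoutesSet Gr D F
  F-routes _ = uniform-routes

  congestion-F : congestion F ≡ 1/ fromℕ (suc (suc ℓ))
  congestion-F = trans (Max-cong nE (λ e → +-identityʳ ∣ r ∣)) (Max-const (suc ℓ ℕ.* suc ℓ) (<⇒≤ (positive⁻¹ r)))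
    where r = 1/ fromℕ (suc (suc ℓ))

  m*congestion²≤1 : fromℕ nE * (congestion F * congestion F) ≤ 1ℚ
  m*congestion²≤1 = begin
    fromℕ nE * (congestion F * congestion F)     ≡⟨ cong (λ c → fromℕ nE * (c * c)) congestion-F ⟩
    fromℕ nE * (r * r)                           ≤⟨ *-monoʳ-≤-nonNeg (r * r) {{nonNegative (0≤p*p r)}} (fromℕ-mono-≤ m≤K²) ⟩
    fromℕ (suc (suc ℓ) ℕ.* suc (suc ℓ)) * (r * r) ≡⟨ cong (_* (r * r)) (fromℕ-* (suc (suc ℓ)) (suc (suc ℓ))) ⟩
    (K * K) * (r * r)                            ≡⟨ *-interchange K K r r ⟩
    (K * r) * (K * r)                            ≡⟨ cong (λ x → x * x) (*-inverseʳ K) ⟩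
    1ℚ                                           ∎
    where
    open ≤-Reasoning
    K = fromℕ (suc (suc ℓ))
    r = 1/ K
    m≤K² : nE ℕ.≤ suc (suc ℓ) ℕ.* suc (suc ℓ)
    m≤K² = ℕ.s≤s (ℕₚ.≤-trans (ℕₚ.*-monoʳ-≤ (suc ℓ) (ℕₚ.n≤1+n (suc ℓ))) (ℕₚ.m≤n+m _ (suc ℓ)))

  ½≤congestion-electric : ∀ P → IsGeneralizedInverse (Lap Gr) P → ½ ≤ congestion (electricSet Gr P D)
  ½≤congestion-electric P LPL≐L =
    subst (_≤ congestion (electricSet Gr P D)) (trans (+-identityʳ _) (cong ∣_∣ chord≡½))
          (≤-Max nE (λ e → Σ 1 (λ τ → ∣ electricSet Gr P D τ e ∣)) chord)
    where
    d = demandVec unit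
    chord≡½ : electric Gr P d chord ≡ ½
    chord≡½ = [p+p]*q≡p⇒q≡½ (fromℕ (suc ℓ)) _
      (potential-flow-on-chord (potential P d) (Electric.electric-routes Gr P LPL≐L {uniform} uniform-routes) (electric-potential Gr P d))

  lower-bound : ∀ P → IsGeneralizedInverse (Lap Gr) P →
                (½ * ½) * ((+ nE / 1) * (congestion F * congestion F))
                  ≤ congestion (electricSet Gr P D) * congestion (electricSet Gr P D)
  lower-bound P LPL≐L = begin
    (½ * ½) * ((+ nE / 1) * (congestion F * congestion F))   ≡⟨ cong (λ m → (½ * ½) * (m * (congestion F * congestion F))) (n/1≡fromℕ nE) ⟩
    (½ * ½) * (fromℕ nE * (congestion F * congestion F))     ≤⟨ *-monoˡ-≤-nonNeg (½ * ½) m*congestion²≤1 ⟩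
    (½ * ½) * 1ℚ                                             ≡⟨ *-identityʳ (½ * ½) ⟩
    ½ * ½                                                    ≤⟨ p≤q⇒p*p≤q*q (<⇒≤ (positive⁻¹ ½)) (½≤congestion-electric P LPL≐L) ⟩
    congestion (electricSet Gr P D) * congestion (electricSet Gr P D) ∎
    where open ≤-Reasoning

  lower-bound-witness : ∀ P → IsPseudoinverse (Lap Gr) P →
    ∃[ k′ ] Σ[ D′ ∈ DemandSet nV k′ ] Σ[ F′ ∈ (Fin k′ → Fin nE → ℚ) ]
      RoutesSet Gr D′ F′ × (0ℚ < congestion F′) ×
      ((½ * ½) * ((+ nE / 1) * (congestion F′ * congestion F′))
         ≤ congestion (electricSet Gr P D′) * congestion (electricSet Gr P D′))
  lower-bound-witness P (LPL≐L , _) =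
    1 , D , F , F-routes , subst (0ℚ <_) (sym congestion-F) (positive⁻¹ _) , lower-bound P LPL≐L

nE-diverges : Diverges BalancedTheta.nE
nE-diverges M = M , λ i M≤i → ℕₚ.≤-trans M≤i (i≤nE i)
  where
  i≤nE : ∀ i → i ℕ.≤ BalancedTheta.nE i
  i≤nE i = begin
    i                             ≤⟨ ℕₚ.m≤n+m i 2 ⟩
    suc (suc i)                   ≤⟨ ℕₚ.m≤m*n (suc (suc i)) (suc (suc i)) ⟩
    suc (suc i) ℕ.* suc (suc i)   ≤⟨ ℕₚ.n≤1+n _ ⟩
    BalancedTheta.nE i            ∎
    where open ℕₚ.≤-Reasoning

theorem2 :
    (∃[ C ] (0ℚ < C) ×
      (∀ (n m : ℕ) (G : Graph n m) → Connected G →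
       ∀ (P : Matrix n n) → IsPseudoinverse (Lap G) P →
       ∀ (k : ℕ) (D : DemandSet n k) (F : Fin k → Fin m → ℚ) → RoutesSet G D F →
       congestion (electricSet G P D) * congestion (electricSet G P D)
         ≤ (C * C) * ((+ m / 1) * (congestion F * congestion F))))
    ×
    (∃[ c ] (0ℚ < c) ×
      Σ[ ns ∈ (ℕ → ℕ) ] Σ[ ms ∈ (ℕ → ℕ) ]
      Σ[ G ∈ ((i : ℕ) → Graph (ns i) (ms i)) ]
        Diverges ms ×
        (∀ i → Connected (G i)) ×
        (∀ i → ∀ (P : Matrix (ns i) (ns i)) → IsPseudoinverse (Lap (G i)) P →
          ∃[ k ] Σ[ D ∈ DemandSet (ns i) k ] Σ[ F ∈ (Fin k → Fin (ms i) → ℚ) ]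
            RoutesSet (G i) D F × (0ℚ < congestion F) ×
            ((c * c) * ((+ ms i / 1) * (congestion F * congestion F))
               ≤ congestion (electricSet (G i) P D) * congestion (electricSet (G i) P D))))
theorem2 =
  (1ℚ , positive⁻¹ 1ℚ , upper) ,
  (½ , positive⁻¹ ½ , BalancedTheta.nV , BalancedTheta.nE , BalancedTheta.Gr ,
   nE-diverges , BalancedTheta.connected , BalancedTheta.lower-bound-witness)
  where
  upper : ∀ n m (G : Graph n m) → Connected G → ∀ P → IsPseudoinverse (Lap G) P →
          ∀ k (D : DemandSet n k) F → RoutesSet G D F →
          congestion (electricSet G P D) * congestion (electricSet G P D)
            ≤ (1ℚ * 1ℚ) * ((+ m / 1) * (congestion F * congestion F))
  upper n m G _ P (LPL≐L , _) k D F routes =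
    subst (_ ≤_) (sym (trans (*-identityˡ _) (cong (_* (congestion F * congestion F)) (n/1≡fromℕ m))))
          (Electric.electric-congestion²≤m*congestion² G P LPL≐L D F routes)
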